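{- Let $n,k$ be positive integers and let $\mathcal{P}(n,1,1)$ be the set of lattice paths with steps $U=(1,1)$ and $D=(1,-1)$ from $(0,0)$ to $(2n+1,1)$. For each $j=1,\dots,2n+1$, the number of paths in $\mathcal{P}(n,1,1)$ with exactly $k$ circular peaks and exactly $j$ vertices on or below the $x$-axis is independent of $j$ and equals $$N(n,k)=\frac{1}{2n+1}\left(\binom{n}{k-1}\binom{n}{k}+\binom{n+1}{k}\binom{n-1}{k-1}\right).$$
   Context: For a path $p\in\mathcal{P}(n,1,1)$ written as a word in $U,D$, every peak (occurrence of $UD$) is a circular peak; in addition, if $p$ starts with a down step and ends with an up step, its initial vertex is also a circular peak. The vertices of a path are the origin and the successive endpoints of its steps. -}

module Defs where

open import Data.Nat using (ℕ; zero; suc; _+_; _*_)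
open import Data.Integer as ℤ using (ℤ; +_; _≤ᵇ_)
open import Data.Bool using (Bool; true; false; if_then_else_; _∧_)
open import Data.List using (List; []; _∷_; _++_; map; length; filter)
open import Data.Vec using (Vec; []; _∷_; head; last)
open import Relation.Nullary using (Dec; yes; no)
open import Relation.Nullary.Decidable using (⌊_⌋)
open import Relation.Binary.PropositionalEquality using (_≡_; refl)
open import Data.Nat.Properties using (_≟_)

data Step : Set where
  U D : Step

allWords : (m : ℕ) → List (Vec Step m)
allWords zero = [] ∷ []
allWords (suc m) = map (U ∷_) (allWords m) ++ map (D ∷_) (allWords m)

#U : ∀ {m} → Vec Step m → ℕ
#U [] = 0
#U (U ∷ w) = suc (#U w)
#U (D ∷ w) = #U w

stepℤ : Step → ℤ
stepℤ U = + 1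
stepℤ D = ℤ.-[1+ 0 ]

#belowFrom : ∀ {m} → ℤ → Vec Step m → ℕ
#belowFrom h [] = if h ≤ᵇ + 0 then 1 else 0
#belowFrom h (s ∷ w) = (if h ≤ᵇ + 0 then 1 else 0) + #belowFrom (h ℤ.+ stepℤ s) w

#below : ∀ {m} → Vec Step m → ℕ
#below w = #belowFrom (+ 0) w

#peaks : ∀ {m} → Vec Step m → ℕ
#peaks [] = 0
#peaks (s ∷ []) = 0
#peaks (U ∷ D ∷ w) = suc (#peaks (D ∷ w))
#peaks (U ∷ U ∷ w) = #peaks (U ∷ w)
#peaks (D ∷ t ∷ w) = #peaks (t ∷ w)

-- Extra circular peak at the initial vertex: starts with D and ends with U
initialCircular : ∀ {m} → Vec Step m → ℕ
initialCircular [] = 0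
initialCircular (D ∷ w) = isU (last (D ∷ w))
  where
  isU : Step → ℕ
  isU U = 1
  isU D = 0
initialCircular (U ∷ w) = 0

#circularPeaks : ∀ {m} → Vec Step m → ℕ
#circularPeaks w = #peaks w + initialCircular w

-- P(n,1,1): paths from (0,0) to (2n+1,1), i.e. words of length 2n+1 with n+1 U's
-- number of paths in P(n,1,1) with exactly k circular peaks and exactly j
-- vertices on or below the x-axis
countP : (n k j : ℕ) → ℕ
countP n k j = length (filter (λ w → (#U w ≟ suc n)) 
                (filter (λ w → #circularPeaks w ≟ k)
                  (filter (λ w → #below w ≟ j) (allWords (suc (2 * n))))))

-- Rotating a path (moving its first step to the end) preserves its numbers of up-steps and of
-- circular peaks. For a path ending at height 1, the number of vertices on or below the axis
-- after rotating it to start at vertex r is the rank of r when the vertices 0, …, 2n are ordered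
-- by height, ties broken in favour of the later vertex. These ranks are distinct, so every
-- j ∈ [1, 2n+1] is attained by exactly one rotation (the cycle lemma). Hence 2n+1 times the
-- number of paths with j such vertices is the number of all paths with n+1 up-steps and k
-- circular peaks. Splitting off the first step x, such a path is
-- x w read cyclically; its circular peaks are the peaks of the word x w x, and a word with p
-- peaks is determined by how its up-steps and its down-steps are cut into runs, which are
-- counted by compositions, i.e. binomial coefficients.

module Submission where

open import Defs
open import Data.Nat using (ℕ; suc; _+_; _*_; _∸_; _≤_)
open import Data.Nat.Combinatorics using (_C_)
open import Relation.Binary.PropositionalEquality using (_≡_)

open import Data.Bool using (true; false; if_then_else_; T)
open import Data.Empty using (⊥-elim)
open import Data.Integer as ℤ using (ℤ; 0ℤ; 1ℤ)
import Data.Integer.Properties as ℤₚ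
import Data.Integer.Solver
open import Data.List using ([]; _∷_; _++_; map; length; filter)
open import Data.List.Properties using (map-++; map-∘)
open import Data.Nat using (zero; _<_; z≤n; s≤s)
open import Data.Nat.Combinatorics using (nCk+nC[k+1]≡[n+1]C[k+1])
open import Data.Nat.ListAction using (sum)
open import Data.Nat.ListAction.Properties using (sum-++)
import Data.Nat.Properties as ℕₚ
import Data.Nat.Solver
open import Algebra.Properties.CommutativeSemigroup ℕₚ.+-commutativeSemigroup using (interchange)
open import Data.Product using (_×_; _,_)
open import Data.Sum using (_⊎_; inj₁; inj₂)
open import Data.Unit using (tt)
open import Data.Vec using (Vec; []; _∷_; _∷ʳ_; last)
open import Function using (_∘_)
open import Relation.Binary.Definitions using (tri<; tri≈; tri>)
open import Relation.Binary.PropositionalEquality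
  using (_≢_; refl; sym; trans; cong; cong₂; subst; subst₂; module ≡-Reasoning)
open import Relation.Nullary using (Dec; yes; no; does; ¬_)
open import Relation.Nullary.Decidable using (_⊎-dec_; _×-dec_)

open ≡-Reasoning
module ℤ-Solver = Data.Integer.Solver.+-*-Solver
module ℕ-Solver = Data.Nat.Solver.+-*-Solver

𝟙 : {P : Set} → Dec P → ℕ
𝟙 d = if does d then 1 else 0

𝟙-yes : ∀ {P : Set} (d : Dec P) → P → 𝟙 d ≡ 1
𝟙-yes (yes _) _ = refl
𝟙-yes (no ¬p) p = ⊥-elim (¬p p)

𝟙-no : ∀ {P : Set} (d : Dec P) → ¬ P → 𝟙 d ≡ 0
𝟙-no (yes p) ¬p = ⊥-elim (¬p p)
𝟙-no (no _) _ = refl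

𝟙≤1 : ∀ {P : Set} (d : Dec P) → 𝟙 d ≤ 1
𝟙≤1 (yes _) = s≤s z≤n
𝟙≤1 (no _) = z≤n

𝟙-mono : ∀ {P Q : Set} (d : Dec P) (e : Dec Q) → (P → Q) → 𝟙 d ≤ 𝟙 e
𝟙-mono (yes p) e f = ℕₚ.≤-reflexive (sym (𝟙-yes e (f p)))
𝟙-mono (no _) e f = z≤n

𝟙-cong : ∀ {P Q : Set} (d : Dec P) (e : Dec Q) → (P → Q) → (Q → P) → 𝟙 d ≡ 𝟙 e
𝟙-cong d e f g = ℕₚ.≤-antisym (𝟙-mono d e f) (𝟙-mono e d g)

if-then-1-else-0≡𝟙 : ∀ b {P : Set} (d : Dec P) → (T b → P) → (P → T b) → (if b then 1 else 0) ≡ 𝟙 d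
if-then-1-else-0≡𝟙 true d f g = sym (𝟙-yes d (f tt))
if-then-1-else-0≡𝟙 false d f g = sym (𝟙-no d g)

∑< : ℕ → (ℕ → ℕ) → ℕ
∑< zero f = 0
∑< (suc N) f = f 0 + ∑< N (λ r → f (suc r))

syntax ∑< N (λ r → f) = ∑[ r < N ] f

∑-cong : ∀ N {f g : ℕ → ℕ} → (∀ r → r < N → f r ≡ g r) → ∑< N f ≡ ∑< N g
∑-cong zero h = refl
∑-cong (suc N) h = cong₂ _+_ (h 0 (s≤s z≤n)) (∑-cong N (λ r r<N → h (suc r) (s≤s r<N)))

∑-zero : ∀ N {f : ℕ → ℕ} → (∀ r → r < N → f r ≡ 0) → ∑< N f ≡ 0
∑-zero zero h = refl
∑-zero (suc N) h = cong₂ _+_ (h 0 (s≤s z≤n)) (∑-zero N (λ r r<N → h (suc r) (s≤s r<N)))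

∑-last : ∀ N f → ∑< (suc N) f ≡ ∑< N f + f N
∑-last zero f = ℕₚ.+-identityʳ (f 0)
∑-last (suc N) f = trans (cong (f 0 +_) (∑-last N (λ r → f (suc r)))) (sym (ℕₚ.+-assoc (f 0) _ _))

∑-const : ∀ N c → ∑[ r < N ] c ≡ N * c
∑-const zero c = refl
∑-const (suc N) c = cong (c +_) (∑-const N c)

∑-*ʳ : ∀ N f c → ∑[ r < N ] (f r * c) ≡ ∑< N f * c
∑-*ʳ zero f c = refl
∑-*ʳ (suc N) f c = trans (cong (f 0 * c +_) (∑-*ʳ N (λ r → f (suc r)) c)) (sym (ℕₚ.*-distribʳ-+ c (f 0) _))

∑-distrib-+ : ∀ N f g → ∑[ r < N ] (f r + g r) ≡ ∑< N f + ∑< N g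
∑-distrib-+ zero f g = refl
∑-distrib-+ (suc N) f g =
  trans (cong (f 0 + g 0 +_) (∑-distrib-+ N (λ r → f (suc r)) (λ r → g (suc r)))) (interchange (f 0) (g 0) _ _)

∑-comm : ∀ A B (g : ℕ → ℕ → ℕ) → ∑[ a < A ] ∑[ b < B ] g a b ≡ ∑[ b < B ] ∑[ a < A ] g a b
∑-comm zero B g = sym (∑-zero B (λ _ _ → refl))
∑-comm (suc A) B g =
  trans (cong (∑< B (g 0) +_) (∑-comm A B (λ a → g (suc a))))
        (sym (∑-distrib-+ B (g 0) (λ b → ∑[ a < A ] g (suc a) b)))

∑-mono-≤ : ∀ N {f g : ℕ → ℕ} → (∀ r → f r ≤ g r) → ∑< N f ≤ ∑< N g
∑-mono-≤ zero h = z≤n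
∑-mono-≤ (suc N) h = ℕₚ.+-mono-≤ (h 0) (∑-mono-≤ N (λ r → h (suc r)))

∑-mono-< : ∀ N {f g : ℕ → ℕ} → (∀ r → f r ≤ g r) → ∀ t → t < N → f t < g t → ∑< N f < ∑< N g
∑-mono-< (suc N) h zero _ lt = ℕₚ.+-mono-<-≤ lt (∑-mono-≤ N (λ r → h (suc r)))
∑-mono-< (suc N) h (suc t) (s≤s t<N) lt = ℕₚ.+-mono-≤-< (h 0) (∑-mono-< N (λ r → h (suc r)) t t<N lt)

∑-≤-bound : ∀ N f c → (∀ r → r < N → f r ≤ c) → ∑< N f ≤ N * c
∑-≤-bound zero f c h = z≤n
∑-≤-bound (suc N) f c h =
  ℕₚ.+-mono-≤ (h 0 (s≤s z≤n)) (∑-≤-bound N (λ r → f (suc r)) c (λ r r<N → h (suc r) (s≤s r<N)))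

term≤∑ : ∀ N f t → t < N → f t ≤ ∑< N f
term≤∑ (suc N) f zero _ = ℕₚ.m≤m+n (f 0) _
term≤∑ (suc N) f (suc t) (s≤s t<N) = ℕₚ.≤-trans (term≤∑ N (λ r → f (suc r)) t t<N) (ℕₚ.m≤n+m _ (f 0))

∑-𝟙-≟ : ∀ N x → x < N → ∑[ j < N ] 𝟙 (x ℕₚ.≟ j) ≡ 1
∑-𝟙-≟ (suc N) zero _ = cong suc (∑-zero N (λ _ _ → refl))
∑-𝟙-≟ (suc N) (suc x) (s≤s x<N) = ∑-𝟙-≟ N x x<N

∑-𝟙-fiber≤1 : ∀ N (f : ℕ → ℕ) j → (∀ a b → a < N → b < N → f a ≡ f b → a ≡ b) →
              ∑[ r < N ] 𝟙 (f r ℕₚ.≟ j) ≤ 1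
∑-𝟙-fiber≤1 zero f j inj = z≤n
∑-𝟙-fiber≤1 (suc N) f j inj with f 0 ℕₚ.≟ j
... | yes f0≡j = ℕₚ.≤-reflexive (cong₂ _+_ (𝟙-yes (f 0 ℕₚ.≟ j) f0≡j) (∑-zero N λ r r<N →
                   𝟙-no (f (suc r) ℕₚ.≟ j) (λ fr≡j →
                     ℕₚ.0≢1+n (inj 0 (suc r) (s≤s z≤n) (s≤s r<N) (trans f0≡j (sym fr≡j))))))
... | no f0≢j = subst (_≤ 1) (cong (_+ ∑[ r < N ] 𝟙 (f (suc r) ℕₚ.≟ j)) (sym (𝟙-no (f 0 ℕₚ.≟ j) f0≢j)))
                  (∑-𝟙-fiber≤1 N (λ r → f (suc r)) j
                    (λ a b a<N b<N fa≡fb → ℕₚ.suc-injective (inj (suc a) (suc b) (s≤s a<N) (s≤s b<N) fa≡fb)))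

∑≡length⇒term≡1 : ∀ N f → (∀ r → f r ≤ 1) → ∑< N f ≡ N → ∀ t → t < N → f t ≡ 1
∑≡length⇒term≡1 N f f≤1 ∑≡N t t<N with ℕₚ.m≤n⇒m<n∨m≡n (f≤1 t)
... | inj₂ ft≡1 = ft≡1
... | inj₁ ft<1 = ⊥-elim (ℕₚ.<-irrefl (trans ∑≡N (sym (trans (∑-const N 1) (ℕₚ.*-identityʳ N))))
                                       (∑-mono-< N f≤1 t t<N ft<1))

injective⇒hits-once : ∀ M (f : ℕ → ℕ) →
  (∀ a b → a < M → b < M → f a ≡ f b → a ≡ b) → (∀ r → r < M → 1 ≤ f r × f r ≤ M) →
  ∀ j → 1 ≤ j → j ≤ M → ∑[ r < M ] 𝟙 (f r ℕₚ.≟ j) ≡ 1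
injective⇒hits-once M f inj range (suc j) _ j<M =
  ∑≡length⇒term≡1 M fiber (λ i → ∑-𝟙-fiber≤1 M f (suc i) inj) fibers-cover j j<M
  where
  fiber : ℕ → ℕ
  fiber i = ∑[ r < M ] 𝟙 (f r ℕₚ.≟ suc i)
  hit-once : ∀ r → r < M → ∑[ i < M ] 𝟙 (f r ℕₚ.≟ suc i) ≡ 1
  hit-once r r<M with f r | range r r<M
  ... | suc x | _ , x<M = ∑-𝟙-≟ M x x<M
  fibers-cover : ∑< M fiber ≡ M
  fibers-cover = trans (∑-comm M M (λ i r → 𝟙 (f r ℕₚ.≟ suc i)))
                   (trans (∑-cong M hit-once) (trans (∑-const M 1) (ℕₚ.*-identityʳ M)))

∑W : ∀ m → (Vec Step m → ℕ) → ℕ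
∑W zero f = f []
∑W (suc m) f = ∑W m (λ w → f (U ∷ w)) + ∑W m (λ w → f (D ∷ w))

syntax ∑W m (λ w → f) = ∑[ w ∶ Step ^ m ] f

∑W-cong : ∀ m {f g : Vec Step m → ℕ} → (∀ w → f w ≡ g w) → ∑W m f ≡ ∑W m g
∑W-cong zero h = h []
∑W-cong (suc m) h = cong₂ _+_ (∑W-cong m (λ w → h (U ∷ w))) (∑W-cong m (λ w → h (D ∷ w)))

∑W-zero : ∀ m {f : Vec Step m → ℕ} → (∀ w → f w ≡ 0) → ∑W m f ≡ 0
∑W-zero zero h = h []
∑W-zero (suc m) h = cong₂ _+_ (∑W-zero m (λ w → h (U ∷ w))) (∑W-zero m (λ w → h (D ∷ w)))

∑W-distrib-+ : ∀ m (f g : Vec Step m → ℕ) → ∑[ w ∶ Step ^ m ] (f w + g w) ≡ ∑W m f + ∑W m g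
∑W-distrib-+ zero f g = refl
∑W-distrib-+ (suc m) f g =
  trans (cong₂ _+_ (∑W-distrib-+ m (λ w → f (U ∷ w)) (λ w → g (U ∷ w)))
                   (∑W-distrib-+ m (λ w → f (D ∷ w)) (λ w → g (D ∷ w))))
        (interchange (∑W m (λ w → f (U ∷ w))) _ _ _)

∑-∑W-comm : ∀ m N (h : ℕ → Vec Step m → ℕ) →
            ∑[ r < N ] ∑W m (h r) ≡ ∑[ w ∶ Step ^ m ] ∑[ r < N ] h r w
∑-∑W-comm m zero h = sym (∑W-zero m (λ _ → refl))
∑-∑W-comm m (suc N) h = trans (cong (∑W m (h 0) +_) (∑-∑W-comm m N (λ r → h (suc r))))
                              (sym (∑W-distrib-+ m (h 0) (λ w → ∑[ r < N ] h (suc r) w)))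

∑W-snoc : ∀ m (f : Vec Step (suc m) → ℕ) → ∑W (suc m) f ≡ ∑[ w ∶ Step ^ m ] (f (w ∷ʳ U) + f (w ∷ʳ D))
∑W-snoc zero f = refl
∑W-snoc (suc m) f = cong₂ _+_ (∑W-snoc m (λ w → f (U ∷ w))) (∑W-snoc m (λ w → f (D ∷ w)))

rotate : ∀ {m} → Vec Step (suc m) → Vec Step (suc m)
rotate (x ∷ w) = w ∷ʳ x

rotate^ : ∀ {m} → ℕ → Vec Step (suc m) → Vec Step (suc m)
rotate^ zero v = v
rotate^ (suc r) v = rotate^ r (rotate v)

∑W-rotate : ∀ m (f : Vec Step (suc m) → ℕ) → ∑[ v ∶ Step ^ suc m ] f (rotate v) ≡ ∑W (suc m) f
∑W-rotate m f = trans (sym (∑W-distrib-+ m (λ w → f (w ∷ʳ U)) (λ w → f (w ∷ʳ D)))) (sym (∑W-snoc m f))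

∑W-rotate^ : ∀ m r (f : Vec Step (suc m) → ℕ) → ∑[ v ∶ Step ^ suc m ] f (rotate^ r v) ≡ ∑W (suc m) f
∑W-rotate^ m zero f = refl
∑W-rotate^ m (suc r) f = trans (∑W-rotate m (λ v → f (rotate^ r v))) (∑W-rotate^ m r f)

rotate^-invariant : ∀ {m} {A : Set} (F : Vec Step (suc m) → A) → (∀ v → F (rotate v) ≡ F v) →
                    ∀ r v → F (rotate^ r v) ≡ F v
rotate^-invariant F inv zero v = refl
rotate^-invariant F inv (suc r) v = trans (rotate^-invariant F inv r (rotate v)) (inv v)

∑-filter : ∀ {A : Set} {P : A → Set} (P? : ∀ x → Dec (P x)) (g : A → ℕ) xs →
           sum (map g (filter P? xs)) ≡ sum (map (λ x → 𝟙 (P? x) * g x) xs)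
∑-filter P? g [] = refl
∑-filter P? g (x ∷ xs) with does (P? x)
... | true = cong₂ _+_ (sym (ℕₚ.+-identityʳ (g x))) (∑-filter P? g xs)
... | false = ∑-filter P? g xs

length-filter : ∀ {A : Set} {P : A → Set} (P? : ∀ x → Dec (P x)) xs →
                length (filter P? xs) ≡ sum (map (λ x → 𝟙 (P? x)) xs)
length-filter P? [] = refl
length-filter P? (x ∷ xs) with does (P? x)
... | true = cong suc (length-filter P? xs)
... | false = length-filter P? xs

∑-allWords : ∀ m (f : Vec Step m → ℕ) → sum (map f (allWords m)) ≡ ∑W m f
∑-allWords zero f = ℕₚ.+-identityʳ (f [])
∑-allWords (suc m) f = begin
  sum (map f (map (U ∷_) ws ++ map (D ∷_) ws))
    ≡⟨ cong sum (map-++ f (map (U ∷_) ws) (map (D ∷_) ws)) ⟩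
  sum (map f (map (U ∷_) ws) ++ map f (map (D ∷_) ws))
    ≡⟨ sum-++ (map f (map (U ∷_) ws)) _ ⟩
  sum (map f (map (U ∷_) ws)) + sum (map f (map (D ∷_) ws))
    ≡⟨ cong₂ _+_ (cong sum (sym (map-∘ ws))) (cong sum (sym (map-∘ ws))) ⟩
  sum (map (λ w → f (U ∷ w)) ws) + sum (map (λ w → f (D ∷ w)) ws)
    ≡⟨ cong₂ _+_ (∑-allWords m (λ w → f (U ∷ w))) (∑-allWords m (λ w → f (D ∷ w))) ⟩
  ∑W (suc m) f ∎
  where
  ws = allWords m

-- heights and the rank of a vertex

height : ∀ {m} → Vec Step m → ℕ → ℤ
height w zero = 0ℤ
height [] (suc s) = 0ℤ
height (x ∷ w) (suc s) = stepℤ x ℤ.+ height w s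

_≼_ : ℤ × ℕ → ℤ × ℕ → Set
(a , s) ≼ (b , r) = a ℤ.< b ⊎ (a ≡ b × r ≤ s)

_≼?_ : ∀ k l → Dec (k ≼ l)
(a , s) ≼? (b , r) = (a ℤₚ.<? b) ⊎-dec ((a ℤₚ.≟ b) ×-dec (r ℕₚ.≤? s))

≼-refl : ∀ k → k ≼ k
≼-refl (a , s) = inj₂ (refl , ℕₚ.≤-refl)

≼-trans : ∀ {k l o} → k ≼ l → l ≼ o → k ≼ o
≼-trans (inj₁ a<b) (inj₁ b<c) = inj₁ (ℤₚ.<-trans a<b b<c)
≼-trans (inj₁ a<b) (inj₂ (refl , _)) = inj₁ a<b
≼-trans (inj₂ (refl , _)) (inj₁ b<c) = inj₁ b<c
≼-trans (inj₂ (refl , r≤s)) (inj₂ (refl , t≤r)) = inj₂ (refl , ℕₚ.≤-trans t≤r r≤s)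

≼-antisym : ∀ {a s b r} → (a , s) ≼ (b , r) → (b , r) ≼ (a , s) → s ≡ r
≼-antisym (inj₁ a<b) (inj₁ b<a) = ⊥-elim (ℤₚ.<-asym a<b b<a)
≼-antisym (inj₁ a<b) (inj₂ (refl , _)) = ⊥-elim (ℤₚ.<-irrefl refl a<b)
≼-antisym (inj₂ (refl , _)) (inj₁ b<a) = ⊥-elim (ℤₚ.<-irrefl refl b<a)
≼-antisym (inj₂ (_ , r≤s)) (inj₂ (_ , s≤r)) = ℕₚ.≤-antisym s≤r r≤s

≼-total : ∀ k l → k ≼ l ⊎ l ≼ k
≼-total (a , s) (b , r) with ℤₚ.<-cmp a b | ℕₚ.≤-total r s
... | tri< a<b _ _ | _ = inj₁ (inj₁ a<b)
... | tri> _ _ b<a | _ = inj₂ (inj₁ b<a)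
... | tri≈ _ a≡b _ | inj₁ r≤s = inj₁ (inj₂ (a≡b , r≤s))
... | tri≈ _ a≡b _ | inj₂ s≤r = inj₂ (inj₂ (sym a≡b , s≤r))

≼⇒≤ : ∀ {a s b r} → (a , s) ≼ (b , r) → a ℤ.≤ b
≼⇒≤ (inj₁ a<b) = ℤₚ.<⇒≤ a<b
≼⇒≤ (inj₂ (refl , _)) = ℤₚ.≤-refl

≤⇒≼ : ∀ {a s b r} → r ≤ s → a ℤ.≤ b → (a , s) ≼ (b , r)
≤⇒≼ {a} {b = b} r≤s a≤b with a ℤₚ.≟ b
... | yes a≡b = inj₂ (a≡b , r≤s)
... | no a≢b = inj₁ (ℤₚ.≤∧≢⇒< a≤b a≢b)

key : ∀ {m} → Vec Step m → ℕ → ℤ × ℕ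
key w s = height w s , s

rank : ∀ {m} → Vec Step m → ℕ → ℕ
rank {m} w r = ∑[ s < m ] 𝟙 (key w s ≼? key w r)

rank-≤ : ∀ {m} (w : Vec Step m) r → rank w r ≤ m
rank-≤ {m} w r =
  subst (rank w r ≤_) (ℕₚ.*-identityʳ m) (∑-≤-bound m _ 1 (λ s _ → 𝟙≤1 (key w s ≼? key w r)))

rank-≥1 : ∀ {m} (w : Vec Step m) r → r < m → 1 ≤ rank w r
rank-≥1 {m} w r r<m = subst (_≤ rank w r) (𝟙-yes (key w r ≼? key w r) (≼-refl (key w r)))
                        (term≤∑ m (λ s → 𝟙 (key w s ≼? key w r)) r r<m)

rank-< : ∀ {m} (w : Vec Step m) r t → t < m → r ≢ t → key w r ≼ key w t → rank w r < rank w t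
rank-< {m} w r t t<m r≢t r≼t = ∑-mono-< m
  (λ s → 𝟙-mono (key w s ≼? key w r) (key w s ≼? key w t) (λ s≼r → ≼-trans s≼r r≼t)) t t<m
  (subst₂ _<_ (sym (𝟙-no (key w t ≼? key w r) (λ t≼r → r≢t (sym (≼-antisym t≼r r≼t)))))
              (sym (𝟙-yes (key w t ≼? key w t) (≼-refl (key w t)))) (s≤s z≤n))

rank-injective : ∀ {m} (w : Vec Step m) r t → r < m → t < m → rank w r ≡ rank w t → r ≡ t
rank-injective w r t r<m t<m eq with r ℕₚ.≟ t
... | yes r≡t = r≡t
... | no r≢t with ≼-total (key w r) (key w t)
...   | inj₁ r≼t = ⊥-elim (ℕₚ.<-irrefl eq (rank-< w r t t<m r≢t r≼t))
...   | inj₂ t≼r = ⊥-elim (ℕₚ.<-irrefl (sym eq) (rank-< w t r r<m (r≢t ∘ sym) t≼r))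

-- the cycle lemma

+-cancelˡ-< : ∀ c {a b} → c ℤ.+ a ℤ.< c ℤ.+ b → a ℤ.< b
+-cancelˡ-< c lt = ℤₚ.≰⇒> (λ b≤a → ℤₚ.<⇒≱ lt (ℤₚ.+-monoʳ-≤ c b≤a))

+-cancelˡ-≤ : ∀ c {a b} → c ℤ.+ a ℤ.≤ c ℤ.+ b → a ℤ.≤ b
+-cancelˡ-≤ c le = ℤₚ.≮⇒≥ (λ b<a → ℤₚ.<⇒≱ (ℤₚ.+-monoʳ-< c b<a) le)

+-cancelˡ-≡ : ∀ c {a b} → c ℤ.+ a ≡ c ℤ.+ b → a ≡ b
+-cancelˡ-≡ c eq =
  ℤₚ.≤-antisym (+-cancelˡ-≤ c (ℤₚ.≤-reflexive eq)) (+-cancelˡ-≤ c (ℤₚ.≤-reflexive (sym eq)))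

≼-shift : ∀ c {a s b r} → (a , s) ≼ (b , r) → (c ℤ.+ a , suc s) ≼ (c ℤ.+ b , suc r)
≼-shift c (inj₁ a<b) = inj₁ (ℤₚ.+-monoʳ-< c a<b)
≼-shift c (inj₂ (a≡b , r≤s)) = inj₂ (cong (ℤ._+_ c) a≡b , s≤s r≤s)

≼-unshift : ∀ c {a s b r} → (c ℤ.+ a , suc s) ≼ (c ℤ.+ b , suc r) → (a , s) ≼ (b , r)
≼-unshift c (inj₁ lt) = inj₁ (+-cancelˡ-< c lt)
≼-unshift c (inj₂ (eq , s≤s r≤s)) = inj₂ (+-cancelˡ-≡ c eq , r≤s)

height-∷ʳ : ∀ {m} (w : Vec Step m) x s → s ≤ m → height (w ∷ʳ x) s ≡ height w s
height-∷ʳ w x zero _ = refl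
height-∷ʳ (y ∷ w) x (suc s) (s≤s s≤m) = cong (ℤ._+_ (stepℤ y)) (height-∷ʳ w x s s≤m)

height-∷ʳ-end : ∀ {m} (w : Vec Step m) x → height (w ∷ʳ x) (suc m) ≡ height w m ℤ.+ stepℤ x
height-∷ʳ-end [] x = ℤₚ.+-comm (stepℤ x) 0ℤ
height-∷ʳ-end (y ∷ w) x =
  trans (cong (ℤ._+_ (stepℤ y)) (height-∷ʳ-end w x)) (sym (ℤₚ.+-assoc (stepℤ y) _ (stepℤ x)))

height-rotate : ∀ {m} (v : Vec Step (suc m)) → height (rotate v) (suc m) ≡ height v (suc m)
height-rotate {m} (x ∷ w) = trans (height-∷ʳ-end w x) (ℤₚ.+-comm (height w m) (stepℤ x))

height+length : ∀ {m} (w : Vec Step m) → ℤ.+ m ℤ.+ height w m ≡ ℤ.+ #U w ℤ.+ ℤ.+ #U w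
height+length [] = refl
height+length {suc m} (U ∷ w) = begin
  (1ℤ ℤ.+ ℤ.+ m) ℤ.+ (1ℤ ℤ.+ height w m)  ≡⟨ solve 2 (λ l h → (con 1ℤ :+ l) :+ (con 1ℤ :+ h) := (l :+ h) :+ con (ℤ.+ 2))
                                                      refl (ℤ.+ m) (height w m) ⟩
  (ℤ.+ m ℤ.+ height w m) ℤ.+ ℤ.+ 2        ≡⟨ cong (ℤ._+ ℤ.+ 2) (height+length w) ⟩
  (ℤ.+ #U w ℤ.+ ℤ.+ #U w) ℤ.+ ℤ.+ 2       ≡⟨ solve 1 (λ u → (u :+ u) :+ con (ℤ.+ 2) := (con 1ℤ :+ u) :+ (con 1ℤ :+ u))
                                                      refl (ℤ.+ #U w) ⟩
  (1ℤ ℤ.+ ℤ.+ #U w) ℤ.+ (1ℤ ℤ.+ ℤ.+ #U w) ∎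
  where open ℤ-Solver
height+length {suc m} (D ∷ w) =
  trans (solve 2 (λ l h → (con 1ℤ :+ l) :+ (con ℤ.-1ℤ :+ h) := l :+ h) refl (ℤ.+ m) (height w m)) (height+length w)
  where open ℤ-Solver

height-end≡1 : ∀ n (w : Vec Step (suc (2 * n))) → #U w ≡ suc n → height w (suc (2 * n)) ≡ 1ℤ
height-end≡1 n w #U≡1+n = +-cancelˡ-≡ (ℤ.+ suc (2 * n)) (begin
  ℤ.+ suc (2 * n) ℤ.+ height w (suc (2 * n)) ≡⟨ height+length w ⟩
  ℤ.+ #U w ℤ.+ ℤ.+ #U w                     ≡⟨ cong (λ u → ℤ.+ (u + u)) #U≡1+n ⟩
  ℤ.+ (suc n + suc n)                        ≡⟨ cong ℤ.+_ (solve 1 (λ n → (con 1 :+ n) :+ (con 1 :+ n)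
                                                                 := (con 1 :+ con 2 :* n) :+ con 1) refl n) ⟩
  ℤ.+ suc (2 * n) ℤ.+ 1ℤ ∎)
  where open ℕ-Solver

-- Moving the first step to the end turns vertex r + 1 into vertex r and the
-- origin into the last vertex, and preserves the order of the keys.
rank-rotate : ∀ {m} x (w : Vec Step m) r → height (x ∷ w) (suc m) ≡ 1ℤ → r < m →
              rank (w ∷ʳ x) r ≡ rank (x ∷ w) (suc r)
rank-rotate {m} x w r total r<m = begin
  rank (w ∷ʳ x) r                                   ≡⟨ ∑-last m (λ s → 𝟙 (key v s ≼? key v r)) ⟩
  ∑[ s < m ] 𝟙 (key v s ≼? key v r) + 𝟙 (key v m ≼? key v r)
                                                    ≡⟨ ℕₚ.+-comm _ (𝟙 (key v m ≼? key v r)) ⟩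
  𝟙 (key v m ≼? key v r) + ∑[ s < m ] 𝟙 (key v s ≼? key v r)
                                                    ≡⟨ cong₂ _+_ last-vertex (∑-cong m inner-vertex) ⟩
  rank (x ∷ w) (suc r) ∎
  where
  v = w ∷ʳ x
  c = stepℤ x
  r≤m = ℕₚ.<⇒≤ r<m
  key-∷ʳ : ∀ s → s ≤ m → key v s ≡ key w s
  key-∷ʳ s s≤m = cong (_, s) (height-∷ʳ w x s s≤m)
  inner-vertex : ∀ s → s < m → 𝟙 (key v s ≼? key v r) ≡ 𝟙 (key (x ∷ w) (suc s) ≼? key (x ∷ w) (suc r))
  inner-vertex s s<m = trans (cong₂ (λ k l → 𝟙 (k ≼? l)) (key-∷ʳ s (ℕₚ.<⇒≤ s<m)) (key-∷ʳ r r≤m))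
    (𝟙-cong (key w s ≼? key w r) (_ ≼? _) (≼-shift c) (≼-unshift c))
  -- the last vertex lies at height 1 above the origin
  ≼⇒>0 : key w m ≼ key w r → 0ℤ ℤ.< c ℤ.+ height w r
  ≼⇒>0 m≼r = ℤₚ.suc[i]≤j⇒i<j (subst (ℤ._≤ c ℤ.+ height w r) total (ℤₚ.+-monoʳ-≤ c (≼⇒≤ m≼r)))
  >0⇒≼ : (0ℤ , 0) ≼ key (x ∷ w) (suc r) → key w m ≼ key w r
  >0⇒≼ (inj₁ 0<h) =
    ≤⇒≼ r≤m (+-cancelˡ-≤ c (subst (ℤ._≤ c ℤ.+ height w r) (sym total) (ℤₚ.i<j⇒suc[i]≤j 0<h)))
  last-vertex : 𝟙 (key v m ≼? key v r) ≡ 𝟙 ((0ℤ , 0) ≼? key (x ∷ w) (suc r))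
  last-vertex = trans (cong₂ (λ k l → 𝟙 (k ≼? l)) (key-∷ʳ m ℕₚ.≤-refl) (key-∷ʳ r r≤m))
    (𝟙-cong (key w m ≼? key w r) (_ ≼? _) (inj₁ ∘ ≼⇒>0) >0⇒≼)

vertex-below : ∀ h → (if h ℤ.≤ᵇ 0ℤ then 1 else 0) ≡ 𝟙 (h ℤ.+ 0ℤ ℤₚ.≤? 0ℤ)
vertex-below h = trans (if-then-1-else-0≡𝟙 (h ℤ.≤ᵇ 0ℤ) (h ℤₚ.≤? 0ℤ) ℤₚ.≤ᵇ⇒≤ ℤₚ.≤⇒≤ᵇ)
                       (cong (λ z → 𝟙 (z ℤₚ.≤? 0ℤ)) (sym (ℤₚ.+-identityʳ h)))

#belowFrom≡∑ : ∀ {m} h (w : Vec Step m) → #belowFrom h w ≡ ∑[ s < suc m ] 𝟙 (h ℤ.+ height w s ℤₚ.≤? 0ℤ)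
#belowFrom≡∑ h [] = trans (vertex-below h) (sym (ℕₚ.+-identityʳ _))
#belowFrom≡∑ {suc m} h (x ∷ w) = cong₂ _+_ (vertex-below h) (trans (#belowFrom≡∑ (h ℤ.+ stepℤ x) w)
  (∑-cong (suc m) (λ s _ → cong (λ z → 𝟙 (z ℤₚ.≤? 0ℤ)) (ℤₚ.+-assoc h (stepℤ x) (height w s)))))

-- For a path ending at height 1 the last vertex is never below the axis, and the
-- others are below exactly when their key precedes that of the origin.
#below≡rank0 : ∀ {m} (v : Vec Step (suc m)) → height v (suc m) ≡ 1ℤ → #below v ≡ rank v 0
#below≡rank0 {m} v total = begin
  #below v                                 ≡⟨ #belowFrom≡∑ 0ℤ v ⟩
  ∑< (suc (suc m)) below                   ≡⟨ ∑-last (suc m) below ⟩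
  ∑< (suc m) below + below (suc m)         ≡⟨ cong (∑< (suc m) below +_) last-above ⟩
  ∑< (suc m) below + 0                     ≡⟨ ℕₚ.+-identityʳ _ ⟩
  ∑< (suc m) below                         ≡⟨ ∑-cong (suc m) (λ s _ → 𝟙-cong (_ ℤₚ.≤? 0ℤ) (key v s ≼? key v 0)
                                                (λ h≤0 → ≤⇒≼ z≤n (subst (ℤ._≤ 0ℤ) (ℤₚ.+-identityˡ (height v s)) h≤0))
                                                (λ s≼0 → subst (ℤ._≤ 0ℤ) (sym (ℤₚ.+-identityˡ (height v s))) (≼⇒≤ s≼0))) ⟩
  rank v 0 ∎
  where
  below : ℕ → ℕ
  below s = 𝟙 (0ℤ ℤ.+ height v s ℤₚ.≤? 0ℤ)
  last-above : below (suc m) ≡ 0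
  last-above = 𝟙-no (_ ℤₚ.≤? 0ℤ) (λ h≤0 → ℤₚ.<⇒≱ (ℤ.+<+ (s≤s z≤n))
                 (subst (ℤ._≤ 0ℤ) (trans (ℤₚ.+-identityˡ _) total) h≤0))

#below-rotate^ : ∀ {m} r (v : Vec Step (suc m)) → height v (suc m) ≡ 1ℤ → r < suc m →
                 #below (rotate^ r v) ≡ rank v r
#below-rotate^ zero v total _ = #below≡rank0 v total
#below-rotate^ (suc r) (x ∷ w) total (s≤s r<m) =
  trans (#below-rotate^ r (w ∷ʳ x) (trans (height-rotate (x ∷ w)) total) (ℕₚ.m≤n⇒m≤1+n r<m))
        (rank-rotate x w r total r<m)

cycle-lemma : ∀ {m} (v : Vec Step (suc m)) → height v (suc m) ≡ 1ℤ → ∀ j → 1 ≤ j → j ≤ suc m →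
              ∑[ r < suc m ] 𝟙 (#below (rotate^ r v) ℕₚ.≟ j) ≡ 1
cycle-lemma {m} v total j 1≤j j≤m =
  trans (∑-cong (suc m) (λ r r<m → cong (λ b → 𝟙 (b ℕₚ.≟ j)) (#below-rotate^ r v total r<m)))
        (injective⇒hits-once (suc m) (rank v) (rank-injective v)
                              (λ r r<m → rank-≥1 v r r<m , rank-≤ v r) j 1≤j j≤m)

∑W-rotations : ∀ m N (f : Vec Step (suc m) → ℕ) →
               N * ∑W (suc m) f ≡ ∑[ v ∶ Step ^ suc m ] ∑[ r < N ] f (rotate^ r v)
∑W-rotations m N f = begin
  N * ∑W (suc m) f                                  ≡⟨ sym (∑-const N _) ⟩
  ∑[ r < N ] ∑W (suc m) f                           ≡⟨ ∑-cong N (λ r _ → sym (∑W-rotate^ m r f)) ⟩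
  ∑[ r < N ] ∑[ v ∶ Step ^ suc m ] f (rotate^ r v)  ≡⟨ ∑-∑W-comm (suc m) N (λ r v → f (rotate^ r v)) ⟩
  ∑[ v ∶ Step ^ suc m ] ∑[ r < N ] f (rotate^ r v)  ∎

∑W-#below-uniform : ∀ m (c : Vec Step (suc m) → ℕ) → (∀ v → c (rotate v) ≡ c v) →
            (∀ v → c v ≢ 0 → height v (suc m) ≡ 1ℤ) → ∀ j → 1 ≤ j → j ≤ suc m →
            suc m * ∑[ v ∶ Step ^ suc m ] (𝟙 (#below v ℕₚ.≟ j) * c v) ≡ ∑W (suc m) c
∑W-#below-uniform m c c-rotate support j 1≤j j≤M =
  trans (∑W-rotations m (suc m) (λ v → 𝟙 (#below v ℕₚ.≟ j) * c v)) (∑W-cong (suc m) rotations-of)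
  where
  hits : Vec Step (suc m) → ℕ
  hits v = ∑[ r < suc m ] 𝟙 (#below (rotate^ r v) ℕₚ.≟ j)
  exactly-one-hit : ∀ v → hits v * c v ≡ c v
  exactly-one-hit v with c v ℕₚ.≟ 0
  ... | yes cv≡0 = trans (cong (hits v *_) cv≡0) (trans (ℕₚ.*-zeroʳ (hits v)) (sym cv≡0))
  ... | no cv≢0 = trans (cong (_* c v) (cycle-lemma v (support v cv≢0) j 1≤j j≤M)) (ℕₚ.+-identityʳ (c v))
  rotations-of : ∀ v → ∑[ r < suc m ] (𝟙 (#below (rotate^ r v) ℕₚ.≟ j) * c (rotate^ r v)) ≡ c v
  rotations-of v = trans (∑-cong (suc m) (λ r _ → cong (𝟙 (#below (rotate^ r v) ℕₚ.≟ j) *_)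
                                                        (rotate^-invariant c c-rotate r v)))
                         (trans (∑-*ʳ (suc m) (λ r → 𝟙 (#below (rotate^ r v) ℕₚ.≟ j)) (c v)) (exactly-one-hit v))

-- circular peaks

peak : Step → Step → ℕ
peak _ U = 0
peak U D = 1
peak D D = 0

#peaksIn : ∀ {m} → Step → Vec Step m → Step → ℕ
#peaksIn x [] a = peak x a
#peaksIn x (y ∷ w) a = peak x y + #peaksIn y w a

#peaks-∷ : ∀ {m} x y (w : Vec Step m) → #peaks (x ∷ y ∷ w) ≡ peak x y + #peaks (y ∷ w)
#peaks-∷ U U w = refl
#peaks-∷ U D w = refl
#peaks-∷ D U w = refl
#peaks-∷ D D w = refl

#peaks+peak-last : ∀ {m} x (w : Vec Step m) a → #peaks (x ∷ w) + peak (last (x ∷ w)) a ≡ #peaksIn x w a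
#peaks+peak-last x [] a = refl
#peaks+peak-last x (y ∷ w) a = begin
  #peaks (x ∷ y ∷ w) + peak (last (y ∷ w)) a         ≡⟨ cong (_+ peak (last (y ∷ w)) a) (#peaks-∷ x y w) ⟩
  peak x y + #peaks (y ∷ w) + peak (last (y ∷ w)) a  ≡⟨ ℕₚ.+-assoc (peak x y) _ _ ⟩
  peak x y + (#peaks (y ∷ w) + peak (last (y ∷ w)) a) ≡⟨ cong (peak x y +_) (#peaks+peak-last y w a) ⟩
  #peaksIn x (y ∷ w) a ∎

initialCircular≡peak : ∀ {m} x (w : Vec Step m) → initialCircular (x ∷ w) ≡ peak (last (x ∷ w)) x
initialCircular≡peak U w = refl
initialCircular≡peak D w with last (D ∷ w)
... | U = refl
... | D = refl

#circularPeaks-∷ : ∀ {m} x (w : Vec Step m) → #circularPeaks (x ∷ w) ≡ #peaksIn x w x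
#circularPeaks-∷ x w = trans (cong (#peaks (x ∷ w) +_) (initialCircular≡peak x w)) (#peaks+peak-last x w x)

#peaksIn-∷ʳ : ∀ {m} x (w : Vec Step m) y a → #peaksIn x (w ∷ʳ y) a ≡ #peaksIn x w y + peak y a
#peaksIn-∷ʳ x [] y a = refl
#peaksIn-∷ʳ x (z ∷ w) y a = trans (cong (peak x z +_) (#peaksIn-∷ʳ z w y a)) (sym (ℕₚ.+-assoc (peak x z) _ _))

#circularPeaks-rotate : ∀ {m} (v : Vec Step (suc m)) → #circularPeaks (rotate v) ≡ #circularPeaks v
#circularPeaks-rotate (x ∷ []) = refl
#circularPeaks-rotate (x ∷ y ∷ w) = begin
  #circularPeaks (y ∷ (w ∷ʳ x))   ≡⟨ #circularPeaks-∷ y (w ∷ʳ x) ⟩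
  #peaksIn y (w ∷ʳ x) y           ≡⟨ #peaksIn-∷ʳ y w x y ⟩
  #peaksIn y w x + peak x y       ≡⟨ ℕₚ.+-comm (#peaksIn y w x) (peak x y) ⟩
  #peaksIn x (y ∷ w) x            ≡⟨ sym (#circularPeaks-∷ x (y ∷ w)) ⟩
  #circularPeaks (x ∷ y ∷ w) ∎

#U-∷ʳ : ∀ {m} (w : Vec Step m) x → #U (w ∷ʳ x) ≡ #U (x ∷ w)
#U-∷ʳ [] x = refl
#U-∷ʳ (U ∷ w) U = cong suc (#U-∷ʳ w U)
#U-∷ʳ (U ∷ w) D = cong suc (#U-∷ʳ w D)
#U-∷ʳ (D ∷ w) U = #U-∷ʳ w U
#U-∷ʳ (D ∷ w) D = #U-∷ʳ w D

#U-rotate : ∀ {m} (v : Vec Step (suc m)) → #U (rotate v) ≡ #U v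
#U-rotate (x ∷ w) = #U-∷ʳ w x

#U≤length : ∀ {m} (w : Vec Step m) → #U w ≤ m
#U≤length [] = z≤n
#U≤length (U ∷ w) = s≤s (#U≤length w)
#U≤length (D ∷ w) = ℕₚ.m≤n⇒m≤1+n (#U≤length w)

∑W-too-many-ups : ∀ m i (f : Vec Step m → ℕ) → m ≤ i → ∑[ w ∶ Step ^ m ] (𝟙 (#U w ℕₚ.≟ suc i) * f w) ≡ 0
∑W-too-many-ups m i f m≤i = ∑W-zero m (λ w → cong (_* f w)
  (𝟙-no (#U w ℕₚ.≟ suc i) (λ #U≡1+i → ℕₚ.<-irrefl #U≡1+i (s≤s (ℕₚ.≤-trans (#U≤length w) m≤i)))))

-- compositions x y is the number of ways of writing x as an ordered sum of y positive parts
compositions : ℕ → ℕ → ℕ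
compositions zero zero = 1
compositions zero (suc _) = 0
compositions (suc _) zero = 0
compositions (suc x) (suc y) = compositions x y + compositions x (suc y)

compositions-suc : ∀ x y → compositions (suc x) (suc y) ≡ x C y
compositions-suc zero zero = refl
compositions-suc zero (suc y) = refl
compositions-suc (suc x) zero = compositions-suc x zero
compositions-suc (suc x) (suc y) =
  trans (cong₂ _+_ (compositions-suc x y) (compositions-suc x (suc y))) (nCk+nC[k+1]≡[n+1]C[k+1] x y)

isU isD : Step → ℕ
isU U = 1
isU D = 0
isD U = 0
isD D = 1

#wordsWithPeaks : Step → Step → (m i p : ℕ) → ℕ
#wordsWithPeaks x a m i p = ∑[ w ∶ Step ^ m ] (𝟙 (#U w ℕₚ.≟ i) * 𝟙 (#peaksIn x w a ℕₚ.≟ p))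

-- If w has i up-steps and j down-steps and x w a has p peaks, then x w a consists of
-- p + isU a runs of up-steps and p + isD x runs of down-steps.
peakFormula : Step → Step → (i j p : ℕ) → ℕ
peakFormula x a i j p = compositions (isU x + isU a + i) (isU a + p) * compositions (isD x + isD a + j) (isD x + p)

*-+0 : ∀ x y → x * y + 0 ≡ x * (y + 0)
*-+0 x y = trans (ℕₚ.+-identityʳ (x * y)) (cong (x *_) (sym (ℕₚ.+-identityʳ y)))

#wordsWithPeaks-[] : ∀ x a p → #wordsWithPeaks x a 0 0 p ≡ peakFormula x a 0 0 p
#wordsWithPeaks-[] U U zero = refl
#wordsWithPeaks-[] U U (suc zero) = refl
#wordsWithPeaks-[] U U (suc (suc p)) = refl
#wordsWithPeaks-[] U D zero = refl
#wordsWithPeaks-[] U D (suc zero) = refl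
#wordsWithPeaks-[] U D (suc (suc p)) = refl
#wordsWithPeaks-[] D U zero = refl
#wordsWithPeaks-[] D U (suc zero) = refl
#wordsWithPeaks-[] D U (suc (suc p)) = refl
#wordsWithPeaks-[] D D zero = refl
#wordsWithPeaks-[] D D (suc zero) = refl
#wordsWithPeaks-[] D D (suc (suc p)) = refl

-- The first step of w is either U, or D (creating a peak when the preceding step is U).
mutual
  #wordsWithPeaks-D≡ : ∀ a i j p → #wordsWithPeaks D a (i + j) i p ≡ peakFormula D a i j p
  #wordsWithPeaks-D≡ a zero zero p = #wordsWithPeaks-[] D a p
  #wordsWithPeaks-D≡ a zero (suc j) p =
    trans (cong₂ _+_ (∑W-zero j (λ _ → refl)) (#wordsWithPeaks-D≡ a zero j p)) (no-ups a p)
    where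
    no-ups : ∀ a p → peakFormula D a 0 j p ≡ peakFormula D a 0 (suc j) p
    no-ups U zero = refl
    no-ups U (suc p) = refl
    no-ups D zero = refl
    no-ups D (suc p) = refl
  #wordsWithPeaks-D≡ a (suc i) zero p =
    trans (cong₂ _+_ (#wordsWithPeaks-U≡ a i zero p) (∑W-too-many-ups (i + 0) i _ (ℕₚ.≤-reflexive (ℕₚ.+-identityʳ i))))
          (no-downs a p)
    where
    no-downs : ∀ a p → peakFormula U a i 0 p + 0 ≡ peakFormula D a (suc i) 0 p
    no-downs U p = *-+0 (compositions (suc (suc i)) (suc p)) _
    no-downs D zero = refl
    no-downs D (suc p) = *-+0 (compositions (suc i) (suc p)) _
  #wordsWithPeaks-D≡ a (suc i) (suc j) p =
    trans (cong₂ _+_ (#wordsWithPeaks-U≡ a i (suc j) p)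
                     (trans (cong (λ m → #wordsWithPeaks D a m (suc i) p) (ℕₚ.+-suc i j))
                            (#wordsWithPeaks-D≡ a (suc i) j p)))
          (pascal a)
    where
    pascal : ∀ a → peakFormula U a i (suc j) p + peakFormula D a (suc i) j p ≡ peakFormula D a (suc i) (suc j) p
    pascal U = sym (ℕₚ.*-distribˡ-+ (compositions (suc (suc i)) (suc p)) _ _)
    pascal D = sym (ℕₚ.*-distribˡ-+ (compositions (suc i) p) _ _)

  #wordsWithPeaks-U≡ : ∀ a i j p → #wordsWithPeaks U a (i + j) i p ≡ peakFormula U a i j p
  #wordsWithPeaks-U≡ a zero zero p = #wordsWithPeaks-[] U a p
  #wordsWithPeaks-U≡ a (suc i) j zero =
    trans (cong₂ _+_ (#wordsWithPeaks-U≡ a i j zero)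
                     (∑W-zero (i + j) (λ w → ℕₚ.*-zeroʳ (𝟙 (#U w ℕₚ.≟ suc i)))))
          (more-ups a)
    where
    more-ups : ∀ a → peakFormula U a i j 0 + 0 ≡ peakFormula U a (suc i) j 0
    more-ups U = ℕₚ.+-identityʳ _
    more-ups D = refl
  #wordsWithPeaks-U≡ a zero (suc j) zero =
    trans (cong₂ _+_ (∑W-zero j (λ _ → refl)) (∑W-zero j (λ w → ℕₚ.*-zeroʳ (𝟙 (#U w ℕₚ.≟ 0)))))
          (no-ups a)
    where
    no-ups : ∀ a → 0 ≡ peakFormula U a 0 (suc j) 0
    no-ups U = sym (ℕₚ.*-zeroʳ (compositions 2 1))
    no-ups D = refl
  #wordsWithPeaks-U≡ a zero (suc j) (suc p) =
    trans (cong₂ _+_ (∑W-zero j (λ _ → refl)) (#wordsWithPeaks-D≡ a zero j p)) (no-ups a)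
    where
    no-ups : ∀ a → peakFormula D a 0 j p ≡ peakFormula U a 0 (suc j) (suc p)
    no-ups U = cong (_* compositions (suc j) (suc p)) (sym (ℕₚ.+-identityʳ (compositions 1 (suc p))))
    no-ups D = cong (_* compositions (suc (suc j)) (suc p)) (sym (ℕₚ.+-identityʳ (compositions 0 p)))
  #wordsWithPeaks-U≡ a (suc i) zero (suc p) =
    trans (cong₂ _+_ (#wordsWithPeaks-U≡ a i zero (suc p)) (∑W-too-many-ups (i + 0) i _ (ℕₚ.≤-reflexive (ℕₚ.+-identityʳ i))))
          (no-downs a p)
    where
    no-downs : ∀ a p → peakFormula U a i 0 (suc p) + 0 ≡ peakFormula U a (suc i) 0 (suc p)
    no-downs U p = trans (ℕₚ.+-identityʳ _) (trans (ℕₚ.*-zeroʳ (compositions (suc (suc i)) (suc (suc p))))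
                                                   (sym (ℕₚ.*-zeroʳ (compositions (suc (suc (suc i))) (suc (suc p))))))
    no-downs D zero = ℕₚ.+-identityʳ _
    no-downs D (suc p) = trans (ℕₚ.+-identityʳ _) (trans (ℕₚ.*-zeroʳ (compositions (suc i) (suc (suc p))))
                                                         (sym (ℕₚ.*-zeroʳ (compositions (suc (suc i)) (suc (suc p))))))
  #wordsWithPeaks-U≡ a (suc i) (suc j) (suc p) =
    trans (cong₂ _+_ (#wordsWithPeaks-U≡ a i (suc j) (suc p))
                     (trans (cong (λ m → #wordsWithPeaks D a m (suc i) p) (ℕₚ.+-suc i j))
                            (#wordsWithPeaks-D≡ a (suc i) j p)))
          (pascal a)
    where
    swap-distrib : ∀ x y z → y * z + x * z ≡ (x + y) * z
    swap-distrib x y z = trans (ℕₚ.+-comm (y * z) (x * z)) (sym (ℕₚ.*-distribʳ-+ z x y))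
    pascal : ∀ a → peakFormula U a i (suc j) (suc p) + peakFormula D a (suc i) j p
                   ≡ peakFormula U a (suc i) (suc j) (suc p)
    pascal U = swap-distrib (compositions (suc (suc i)) (suc p)) _ _
    pascal D = swap-distrib (compositions (suc i) p) _ _

hasUpsAndCircularPeaks : ∀ {m} → ℕ → ℕ → Vec Step m → ℕ
hasUpsAndCircularPeaks u k v = 𝟙 (#circularPeaks v ℕₚ.≟ k) * 𝟙 (#U v ℕₚ.≟ u)

hasUpsAndCircularPeaks-rotate : ∀ {m} u k (v : Vec Step (suc m)) →
  hasUpsAndCircularPeaks u k (rotate v) ≡ hasUpsAndCircularPeaks u k v
hasUpsAndCircularPeaks-rotate u k v =
  cong₂ (λ p u′ → 𝟙 (p ℕₚ.≟ k) * 𝟙 (u′ ℕₚ.≟ u)) (#circularPeaks-rotate v) (#U-rotate v)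

hasUpsAndCircularPeaks⇒#U : ∀ {m} u k (v : Vec Step m) → hasUpsAndCircularPeaks u k v ≢ 0 → #U v ≡ u
hasUpsAndCircularPeaks⇒#U u k v has with #U v ℕₚ.≟ u
... | yes #U≡u = #U≡u
... | no #U≢u = ⊥-elim (has (trans (cong (𝟙 (#circularPeaks v ℕₚ.≟ k) *_) (𝟙-no (#U v ℕₚ.≟ u) #U≢u))
                                  (ℕₚ.*-zeroʳ (𝟙 (#circularPeaks v ℕₚ.≟ k)))))

countP≡∑ : ∀ n k j → countP n k j ≡
  ∑[ v ∶ Step ^ suc (2 * n) ] (𝟙 (#below v ℕₚ.≟ j) * hasUpsAndCircularPeaks (suc n) k v)
countP≡∑ n k j = begin
  length (filter ups? (filter peaks? (filter below? ws)))
    ≡⟨ length-filter ups? (filter peaks? (filter below? ws)) ⟩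
  sum (map (λ v → 𝟙 (ups? v)) (filter peaks? (filter below? ws)))
    ≡⟨ ∑-filter peaks? (λ v → 𝟙 (ups? v)) (filter below? ws) ⟩
  sum (map (λ v → 𝟙 (peaks? v) * 𝟙 (ups? v)) (filter below? ws))
    ≡⟨ ∑-filter below? (λ v → 𝟙 (peaks? v) * 𝟙 (ups? v)) ws ⟩
  sum (map (λ v → 𝟙 (below? v) * (𝟙 (peaks? v) * 𝟙 (ups? v))) ws)
    ≡⟨ ∑-allWords (suc (2 * n)) _ ⟩
  ∑[ v ∶ Step ^ suc (2 * n) ] (𝟙 (below? v) * (𝟙 (peaks? v) * 𝟙 (ups? v))) ∎
  where
  ws = allWords (suc (2 * n))
  below? peaks? ups? : (v : Vec Step (suc (2 * n))) → Dec _
  below? v = #below v ℕₚ.≟ j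
  peaks? v = #circularPeaks v ℕₚ.≟ k
  ups? v = #U v ℕₚ.≟ suc n

∑W-hasUpsAndCircularPeaks : ∀ m u k →
  ∑W (suc m) (hasUpsAndCircularPeaks (suc u) k) ≡ #wordsWithPeaks U U m u k + #wordsWithPeaks D D m (suc u) k
∑W-hasUpsAndCircularPeaks m u k = cong₂ _+_ (∑W-cong m (first-step U)) (∑W-cong m (first-step D))
  where
  first-step : ∀ x (w : Vec Step m) →
    hasUpsAndCircularPeaks (suc u) k (x ∷ w) ≡ 𝟙 (#U (x ∷ w) ℕₚ.≟ suc u) * 𝟙 (#peaksIn x w x ℕₚ.≟ k)
  first-step x w = trans (ℕₚ.*-comm (𝟙 (#circularPeaks (x ∷ w) ℕₚ.≟ k)) _)
                         (cong (λ p → 𝟙 (#U (x ∷ w) ℕₚ.≟ suc u) * 𝟙 (p ℕₚ.≟ k)) (#circularPeaks-∷ x w))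

∑W-hasUpsAndCircularPeaks≡binomials : ∀ n k → 1 ≤ n → 1 ≤ k →
  ∑W (suc (2 * n)) (hasUpsAndCircularPeaks (suc n) k)
    ≡ (n C (k ∸ 1)) * (n C k) + ((n + 1) C k) * ((n ∸ 1) C (k ∸ 1))
∑W-hasUpsAndCircularPeaks≡binomials n@(suc n′) k@(suc k′) _ _ = begin
  ∑W (suc (2 * n)) (hasUpsAndCircularPeaks (suc n) k)
    ≡⟨ ∑W-hasUpsAndCircularPeaks (2 * n) n k ⟩
  #wordsWithPeaks U U (2 * n) n k + #wordsWithPeaks D D (2 * n) (suc n) k
    ≡⟨ cong₂ _+_ (trans (cong (λ m → #wordsWithPeaks U U m n k) 2n≡n+n) (#wordsWithPeaks-U≡ U n n k))
                 (trans (cong (λ m → #wordsWithPeaks D D m (suc n) k) 2n≡1+n+n′) (#wordsWithPeaks-D≡ D (suc n) n′ k)) ⟩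
  compositions (2 + n) (1 + k) * compositions n k + compositions (suc n) k * compositions (2 + n′) (1 + k)
    ≡⟨ cong₂ _+_ (cong₂ _*_ (trans (compositions-suc (suc n) k) (cong (_C k) (ℕₚ.+-comm 1 n)))
                            (compositions-suc n′ k′))
                 (cong₂ _*_ (compositions-suc n k′) (compositions-suc n k)) ⟩
  ((n + 1) C k) * ((n ∸ 1) C (k ∸ 1)) + (n C (k ∸ 1)) * (n C k)
    ≡⟨ ℕₚ.+-comm (((n + 1) C k) * ((n ∸ 1) C (k ∸ 1))) _ ⟩
  (n C (k ∸ 1)) * (n C k) + ((n + 1) C k) * ((n ∸ 1) C (k ∸ 1)) ∎
  where
  2n≡n+n : 2 * n ≡ n + n
  2n≡n+n = cong (n +_) (ℕₚ.+-identityʳ n)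
  2n≡1+n+n′ : 2 * n ≡ suc n + n′
  2n≡1+n+n′ = solve 1 (λ n′ → con 2 :* (con 1 :+ n′) := (con 2 :+ n′) :+ n′) refl n′
    where open ℕ-Solver

theorem8 : (n k j : ℕ) → 1 ≤ n → 1 ≤ k → 1 ≤ j → j ≤ 2 * n + 1 →
    (2 * n + 1) * countP n k j
      ≡ (n C (k ∸ 1)) * (n C k) + ((n + 1) C k) * ((n ∸ 1) C (k ∸ 1))
theorem8 n k j 1≤n 1≤k 1≤j j≤2n+1 = begin
  (2 * n + 1) * countP n k j
    ≡⟨ cong₂ _*_ 2n+1≡1+2n (countP≡∑ n k j) ⟩
  suc (2 * n) * ∑[ v ∶ Step ^ suc (2 * n) ] (𝟙 (#below v ℕₚ.≟ j) * hasUpsAndCircularPeaks (suc n) k v)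
    ≡⟨ ∑W-#below-uniform (2 * n) (hasUpsAndCircularPeaks (suc n) k) (hasUpsAndCircularPeaks-rotate (suc n) k)
                          ends-at-1 j 1≤j (subst (j ≤_) 2n+1≡1+2n j≤2n+1) ⟩
  ∑W (suc (2 * n)) (hasUpsAndCircularPeaks (suc n) k)
    ≡⟨ ∑W-hasUpsAndCircularPeaks≡binomials n k 1≤n 1≤k ⟩
  (n C (k ∸ 1)) * (n C k) + ((n + 1) C k) * ((n ∸ 1) C (k ∸ 1)) ∎
  where
  2n+1≡1+2n : 2 * n + 1 ≡ suc (2 * n)
  2n+1≡1+2n = ℕₚ.+-comm (2 * n) 1
  ends-at-1 : ∀ v → hasUpsAndCircularPeaks (suc n) k v ≢ 0 → height v (suc (2 * n)) ≡ 1ℤ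
  ends-at-1 v has = height-end≡1 n v (hasUpsAndCircularPeaks⇒#U (suc n) k v has)
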